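{- For every $N\in\{U,C,I,T,S\}$ and all BCCSP processes $p,q$: if $p\sqsubseteq_{NS}q$ then $\mathit{LGO}_N(p)\subseteq\mathit{LGO}_N(q)$. The converse implication does not hold in general (it fails, e.g., for $N=U$).
   Context: BCCSP processes over a set $\mathit{Act}$: $p ::= \mathbf{0}\mid ap\mid p+q$; transitions $ap\xrightarrow{a}p$, and $p\xrightarrow{a}p'$ implies $p+q\xrightarrow{a}p'$ and $q+p\xrightarrow{a}p'$; $p\overset{\alpha}{\Rightarrow}q$ for sequences. $I(p)=\{a\mid\exists p'.\,p\xrightarrow{a}p'\}$; $T(p)=\{\alpha\mid\exists p'.\,p\overset{\alpha}{\Rightarrow}p'\}$. For a relation $N$, an $N$-constrained simulation is a relation $R$ such that $pRq$ implies $pNq$ and for every $p\xrightarrow{a}p'$ there is $q\xrightarrow{a}q'$ with $p'Rq'$; $p\sqsubseteq_{NS}q$ iff such an $R$ with $pRq$ exists. $U$ is the universal relation; $pIq\iff I(p)=I(q)$; $pCq\iff(I(p)=\emptyset\iff I(q)=\emptyset)$; $pTq\iff T(p)=T(q)$; $pSq$ iff $p$ and $q$ are simulation equivalent ($p\sqsubseteq_{US}q$ and $q\sqsubseteq_{US}p$). Local observation functions: $L_U(p)=\cdot$ (constant); $L_I(p)=I(p)$; $L_C(p)=\mathit{true}$ iff $I(p)=\emptyset$; $L_T(p)=T(p)$; $L_S(p)$ = simulation-equivalence class of $p$. Linear general observations: $\mathit{LGO}_N(p)$ is the set of sequences $L_N(p_0)a_1L_N(p_1)\cdots a_nL_N(p_n)$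 ($n\ge0$) for which there is a path $p=p_0\xrightarrow{a_1}p_1\cdots\xrightarrow{a_n}p_n$. -}

module Defs where

open import Level using (Lift; lift)
open import Data.Unit using (⊤; tt)
open import Data.Product using (Σ; ∃; _×_; _,_)
open import Data.List using (List; []; _∷_)
open import Relation.Nullary using (¬_)
open import Function.Bundles using (_⇔_)

data Proc (Act : Set) : Set where
  𝟎   : Proc Act
  _∙_ : Act → Proc Act → Proc Act
  _+_ : Proc Act → Proc Act → Proc Act

infixr 6 _∙_
infixl 5 _+_

module _ {Act : Set} where

  data _—[_]→_ : Proc Act → Act → Proc Act → Set where
    pre  : ∀ {a p} → (a ∙ p) —[ a ]→ p
    sumL : ∀ {a p q p'} → p —[ a ]→ p' → (p + q) —[ a ]→ p'
    sumR : ∀ {a p q q'} → q —[ a ]→ q' → (p + q) —[ a ]→ q'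

  data _=[_]⇒_ : Proc Act → List Act → Proc Act → Set where
    done : ∀ {p} → p =[ [] ]⇒ p
    step : ∀ {p a p' α p''} → p —[ a ]→ p' → p' =[ α ]⇒ p'' → p =[ a ∷ α ]⇒ p''

  Init : Proc Act → Act → Set
  Init p a = ∃ λ p' → p —[ a ]→ p'

  Traces : Proc Act → List Act → Set
  Traces p α = ∃ λ p' → p =[ α ]⇒ p'

  NoInit : Proc Act → Set
  NoInit p = ∀ a → ¬ Init p a

  IsConstrainedSim : (Proc Act → Proc Act → Set₁) → (Proc Act → Proc Act → Set) → Set₁
  IsConstrainedSim N R =
    (∀ {p q} → R p q → N p q) ×
    (∀ {p q a p'} → R p q → p —[ a ]→ p' → ∃ λ q' → (q —[ a ]→ q') × R p' q')

  _⊑[_]S_ : Proc Act → (Proc Act → Proc Act → Set₁) → Proc Act → Set₁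
  p ⊑[ N ]S q = Σ (Proc Act → Proc Act → Set) λ R → IsConstrainedSim N R × R p q

  UniRel : Proc Act → Proc Act → Set₁
  UniRel _ _ = Lift _ ⊤

  SimEq : Proc Act → Proc Act → Set₁
  SimEq p q = (p ⊑[ UniRel ]S q) × (q ⊑[ UniRel ]S p)

data Rel : Set where
  U C I T S : Rel

module _ {Act : Set} where

  ⟦_⟧ : Rel → Proc Act → Proc Act → Set₁
  ⟦ U ⟧ = UniRel
  ⟦ C ⟧ p q = Lift _ (NoInit p ⇔ NoInit q)
  ⟦ I ⟧ p q = Lift _ (∀ a → Init p a ⇔ Init q a)
  ⟦ T ⟧ p q = Lift _ (∀ α → Traces p α ⇔ Traces q α)
  ⟦ S ⟧ p q = SimEq p q

  -- Sets of actions / traces are predicates compared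
  -- extensionally; the truth value of "I(p) = ∅" is a proposition compared
  -- by logical equivalence; a simulation-equivalence class is represented by
  -- a representative, two classes being equal iff representatives are
  -- simulation equivalent.
  Obs : Rel → Set₁
  Obs U = Lift _ ⊤
  Obs C = Set
  Obs I = Act → Set
  Obs T = List Act → Set
  Obs S = Lift _ (Proc Act)

  ObsEq : (N : Rel) → Obs N → Obs N → Set₁
  ObsEq U _ _ = Lift _ ⊤
  ObsEq C P Q = Lift _ (P ⇔ Q)
  ObsEq I P Q = Lift _ (∀ a → P a ⇔ Q a)
  ObsEq T P Q = Lift _ (∀ α → P α ⇔ Q α)
  ObsEq S (lift p) (lift q) = SimEq p q

  L : (N : Rel) → Proc Act → Obs N
  L U p = lift tt
  L C p = NoInit p
  L I p = Init p
  L T p = Traces p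
  L S p = lift p

  -- Linear general observations: a sequence L(p0) a1 L(p1) ... an L(pn) is
  -- represented as its head observation together with the list of pairs
  -- (a_i , L(p_i)).
  data InLGO (N : Rel) : Proc Act → Obs N → List (Act × Obs N) → Set₁ where
    here  : ∀ {p o} → ObsEq N (L N p) o → InLGO N p o []
    there : ∀ {p o a p' o' s} → ObsEq N (L N p) o → p —[ a ]→ p' →
            InLGO N p' o' s → InLGO N p o ((a , o') ∷ s)

  _⊆LGO[_]_ : Proc Act → Rel → Proc Act → Set₁
  p ⊆LGO[ N ] q = ∀ o s → InLGO N p o s → InLGO N q o s

-- For each N, the constraint ⟦ N ⟧ p q says exactly that L_N(p) and L_N(q) are
-- equal observations.  An N-constrained simulation relating p to q can therefore
-- follow any path of p step by step with a path of q whose states carry the same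
-- observations, so every linear general observation of p is one of q.
-- Conversely, b(c + b) and bc + bb have the same paths but the former is not
-- simulated by the latter: after b the simulating process must commit to c or b.
module Submission where

open import Defs
open import Data.Product using (Σ; ∃; _×_; _,_)
open import Data.Unit using (tt)
open import Level using (lift)
open import Relation.Nullary using (¬_)
open import Relation.Binary.PropositionalEquality using (_≡_; _≢_; refl; sym)
import Function.Properties.Equivalence as ⇔

module _ {Act : Set} where

  ⊑U-trans : {p q r : Proc Act} → p ⊑[ UniRel ]S q → q ⊑[ UniRel ]S r → p ⊑[ UniRel ]S r
  ⊑U-trans {q = q} (R₁ , (_ , sim₁) , pR₁q) (R₂ , (_ , sim₂) , qR₂r) =
    R₁∘R₂ , ((λ _ → lift tt) , sim) , (q , pR₁q , qR₂r)
    where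
    R₁∘R₂ : Proc Act → Proc Act → Set
    R₁∘R₂ x z = ∃ λ y → R₁ x y × R₂ y z

    sim : ∀ {x z a x'} → R₁∘R₂ x z → x —[ a ]→ x' → ∃ λ z' → (z —[ a ]→ z') × R₁∘R₂ x' z'
    sim (y , xR₁y , yR₂z) x→x' with sim₁ xR₁y x→x'
    ... | y' , y→y' , x'R₁y' with sim₂ yR₂z y→y'
    ... | z' , z→z' , y'R₂z' = z' , z→z' , (y' , x'R₁y' , y'R₂z')

  SimEq-sym : {p q : Proc Act} → SimEq p q → SimEq q p
  SimEq-sym (p⊑q , q⊑p) = q⊑p , p⊑q

  SimEq-trans : {p q r : Proc Act} → SimEq p q → SimEq q r → SimEq p r
  SimEq-trans (p⊑q , q⊑p) (q⊑r , r⊑q) = ⊑U-trans p⊑q q⊑r , ⊑U-trans r⊑q q⊑p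

  ObsEq-sym : (N : Rel) {o o' : Obs {Act} N} → ObsEq {Act} N o o' → ObsEq {Act} N o' o
  ObsEq-sym U _ = lift tt
  ObsEq-sym C (lift e) = lift (⇔.sym e)
  ObsEq-sym I (lift e) = lift (λ a → ⇔.sym (e a))
  ObsEq-sym T (lift e) = lift (λ α → ⇔.sym (e α))
  ObsEq-sym S {lift _} {lift _} e = SimEq-sym e

  ObsEq-trans : (N : Rel) {o o' o'' : Obs {Act} N} →
                ObsEq {Act} N o o' → ObsEq {Act} N o' o'' → ObsEq {Act} N o o''
  ObsEq-trans U _ _ = lift tt
  ObsEq-trans C (lift e) (lift f) = lift (⇔.trans e f)
  ObsEq-trans I (lift e) (lift f) = lift (λ a → ⇔.trans (e a) (f a))
  ObsEq-trans T (lift e) (lift f) = lift (λ α → ⇔.trans (e α) (f α))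
  ObsEq-trans S {lift _} {lift _} {lift _} e f = SimEq-trans e f

  ⟦⟧⇒ObsEq-L : (N : Rel) {p q : Proc Act} → ⟦ N ⟧ p q → ObsEq N (L N p) (L N q)
  ⟦⟧⇒ObsEq-L U pNq = pNq
  ⟦⟧⇒ObsEq-L C pNq = pNq
  ⟦⟧⇒ObsEq-L I pNq = pNq
  ⟦⟧⇒ObsEq-L T pNq = pNq
  ⟦⟧⇒ObsEq-L S pNq = pNq

  ⊑S⇒⊆LGO : (N : Rel) (p q : Proc Act) → p ⊑[ ⟦ N ⟧ ]S q → p ⊆LGO[ N ] q
  ⊑S⇒⊆LGO N _ _ (R , (R⊆N , sim) , pRq) _ _ = follow pRq
    where
    relabel : ∀ {p q o} → R p q → ObsEq N (L N p) o → ObsEq N (L N q) o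
    relabel pRq = ObsEq-trans N (ObsEq-sym N (⟦⟧⇒ObsEq-L N (R⊆N pRq)))

    follow : ∀ {p q o s} → R p q → InLGO N p o s → InLGO N q o s
    follow pRq (here e) = here (relabel pRq e)
    follow pRq (there e p→p' rest) with sim pRq p→p'
    ... | _ , q→q' , p'Rq' = there (relabel pRq e) q→q' (follow p'Rq' rest)

  prefix-action : {a b : Act} {p p' : Proc Act} → (b ∙ p) —[ a ]→ p' → a ≡ b
  prefix-action pre = refl

  ⊆LGO-U-⇏⊑S : (b c : Act) → b ≢ c →
    Σ (Proc Act) λ p → Σ (Proc Act) λ q → (p ⊆LGO[ U ] q) × ¬ (p ⊑[ ⟦ U ⟧ ]S q)
  ⊆LGO-U-⇏⊑S b c b≢c = b ∙ (c ∙ 𝟎 + b ∙ 𝟎) , b ∙ c ∙ 𝟎 + b ∙ b ∙ 𝟎 , ⊆LGO , ⋢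
    where
    ⊆LGO : (b ∙ (c ∙ 𝟎 + b ∙ 𝟎)) ⊆LGO[ U ] (b ∙ c ∙ 𝟎 + b ∙ b ∙ 𝟎)
    ⊆LGO _ _ (here e) = here e
    ⊆LGO _ _ (there e pre (here e')) = there e (sumL pre) (here e')
    ⊆LGO _ _ (there e pre (there e' (sumL pre) rest)) = there e (sumL pre) (there e' pre rest)
    ⊆LGO _ _ (there e pre (there e' (sumR pre) rest)) = there e (sumR pre) (there e' pre rest)

    ⋢ : ¬ ((b ∙ (c ∙ 𝟎 + b ∙ 𝟎)) ⊑[ ⟦ U ⟧ ]S (b ∙ c ∙ 𝟎 + b ∙ b ∙ 𝟎))
    ⋢ (R , (_ , sim) , pRq) with sim pRq pre
    ... | _ , sumL pre , R-after-b with sim R-after-b (sumR pre)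
    ...   | _ , c→ , _ = b≢c (prefix-action c→)
    ⋢ (R , (_ , sim) , pRq) | _ , sumR pre , R-after-b with sim R-after-b (sumL pre)
    ...   | _ , b→ , _ = b≢c (sym (prefix-action b→))

proposition4p16 : (Act : Set) →
    ((N : Rel) (p q : Proc Act) → p ⊑[ ⟦ N ⟧ ]S q → p ⊆LGO[ N ] q)
    × ((b c : Act) → b ≢ c →
        Σ (Proc Act) λ p → Σ (Proc Act) λ q →
          (p ⊆LGO[ U ] q) × ¬ (p ⊑[ ⟦ U ⟧ ]S q))
proposition4p16 Act = ⊑S⇒⊆LGO , ⊆LGO-U-⇏⊑S
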